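{- For any integers $a,b$ with $a\ge b\ge 3$, there exists a finite simple graph $G$ with $\chi(G)=a$, $\alpha(G)=b$ and $\chi_2(G)-\chi(G)=\alpha(G)-1$.
   Context: $\chi(G)$ is the chromatic number and $\alpha(G)$ the independence number of $G$. A dynamic coloring of $G$ is a proper vertex coloring such that for every vertex $v$ of degree at least $2$, the neighbours of $v$ receive at least two different colors; $\chi_2(G)$ is the smallest number of colors in a dynamic coloring of $G$. -}

module Defs where

open import Data.Nat using (ℕ; _≤_)
open import Data.Bool using (Bool; true; false; T)
open import Data.Fin using (Fin)
open import Data.Fin.Subset using (Subset; _∈_; ∣_∣)
open import Data.List using (length; filter; allFin)
open import Data.Product using (Σ; _×_; ∃; ∃-syntax)
open import Relation.Binary.PropositionalEquality using (_≡_; _≢_)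
open import Relation.Nullary using (¬_)
open import Relation.Nullary.Decidable using (Dec)
open import Data.Bool.Properties using (T?)

record Graph : Set where
  field
    n     : ℕ
    adj   : Fin n → Fin n → Bool
    sym   : ∀ u v → adj u v ≡ adj v u
    loopless : ∀ v → adj v v ≡ false
open Graph public

Adj : (G : Graph) → Fin (n G) → Fin (n G) → Set
Adj G u v = T (adj G u v)

degree : (G : Graph) → Fin (n G) → ℕ
degree G v = length (filter (λ u → T? (adj G v u)) (allFin (n G)))

IsProper : (G : Graph) {k : ℕ} → (Fin (n G) → Fin k) → Set
IsProper G c = ∀ u v → Adj G u v → c u ≢ c v

Colorable : Graph → ℕ → Set
Colorable G k = Σ (Fin (n G) → Fin k) (IsProper G)

IsDynamic : (G : Graph) {k : ℕ} → (Fin (n G) → Fin k) → Set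
IsDynamic G c = IsProper G c ×
  (∀ v → 2 ≤ degree G v →
     ∃[ u ] ∃[ w ] (Adj G v u × Adj G v w × c u ≢ c w))

DynColorable : Graph → ℕ → Set
DynColorable G k = Σ (Fin (n G) → Fin k) (IsDynamic G)

ChromaticNumber : Graph → ℕ → Set
ChromaticNumber G k = Colorable G k × (∀ m → Colorable G m → k ≤ m)

DynamicChromaticNumber : Graph → ℕ → Set
DynamicChromaticNumber G k = DynColorable G k × (∀ m → DynColorable G m → k ≤ m)

IsIndependent : (G : Graph) → Subset (n G) → Set
IsIndependent G S = ∀ u v → u ∈ S → v ∈ S → ¬ Adj G u v

IndependenceNumber : Graph → ℕ → Set
IndependenceNumber G k =
  (∃[ S ] (IsIndependent G S × ∣ S ∣ ≡ k)) ×
  (∀ S → IsIndependent G S → ∣ S ∣ ≤ k)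

module Submission where

-- Write b = m + 1 and take a > m ≥ 2.  The graph G has vertices
--   X₀ … X_{m-1},  P₀ … P_{m-1}  and  C₀ … C_{a-1},
-- where P and C are cliques, Pᵢ is joined to every Cⱼ except its partner Cᵢ,
-- and Xᵢ is joined exactly to Pᵢ and Cᵢ.
--   * χ(G) = a: C is a clique, and colouring Pᵢ like Cᵢ and every Xᵢ like Cₘ is
--     proper.
--   * α(G) = m + 1: the cliques {Xᵢ, Pᵢ} together with C cover G, so an
--     independent set has at most m + 1 vertices; {X₀, …, X_{m-1}, Cₘ} attains it.
--   * χ₂(G) = a + m: Xᵢ has degree two, so a dynamic colouring separates Pᵢ and
--     Cᵢ; hence P ∪ C is rainbow.  Conversely, disjoint palettes for C and P,
--     with every Xᵢ coloured like Cₘ, give a dynamic colouring.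

open import Defs hiding (sym)
open import Data.Nat using (ℕ; zero; suc; _+_; _≤_; _<_; z≤n; s≤s)
open import Data.Nat.Properties using (≤-trans; ≤-antisym; <⇒≤; <-≤-trans; <-irrefl; m≤m+n; +-comm)
open import Data.Bool using (Bool; true; false; T)
open import Data.Bool.Properties using (T?; T-≡)
open import Data.Fin using (Fin; zero; suc; toℕ; fromℕ<; inject≤; _↑ˡ_; _↑ʳ_; splitAt; join; _≟_)
open import Data.Fin.Properties
  using (suc-injective; injective⇒≤; toℕ<n; toℕ-fromℕ<; toℕ-inject≤; inject≤-injective;
         toℕ-↑ˡ; toℕ-↑ʳ; ↑ˡ-injective; ↑ʳ-injective; splitAt-↑ˡ; splitAt-↑ʳ;
         splitAt⁻¹-↑ˡ; splitAt⁻¹-↑ʳ; join-splitAt)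
open import Data.Fin.Subset using (Subset; inside; outside; _∈_; _-_; ∣_∣; ⊤)
open import Data.Fin.Subset.Properties using (∈⊤; ∣⊤∣≡n; x∈p∧x≢y⇒x∈p-y; x∈p⇒∣p-x∣<∣p∣)
open import Data.List using (List; []; _∷_; length; filter; allFin)
open import Data.List.Membership.Propositional using () renaming (_∈_ to _∈ₗ_)
open import Data.List.Relation.Unary.Any using () renaming (here to hereₗ)
open import Data.List.Membership.Propositional.Properties using (∈-allFin; ∈-filter⁺)
open import Data.Vec using (_∷_; []; here; there; tabulate)
open import Data.Vec.Properties using (lookup∘tabulate; lookup⇒[]=; []=⇒lookup)
open import Data.Product using (_,_; _×_; ∃-syntax; proj₁)
open import Data.Sum using (_⊎_; inj₁; inj₂; [_,_]) renaming (map to ⊎-map)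
open import Data.Empty using (⊥; ⊥-elim)
open import Function using (_∘_)
open import Function.Bundles using (Equivalence)
open import Relation.Nullary using (¬_; yes; no; ¬?)
open import Relation.Nullary.Decidable using (isYes; toWitness; fromWitness)
open import Relation.Binary using (Decidable)
open import Relation.Binary.PropositionalEquality
  using (_≡_; _≢_; refl; sym; trans; cong; subst; subst₂; ≢-sym)

distinct-members⇒length≥2 : ∀ {A : Set} {x y : A} {xs : List A} →
  x ≢ y → x ∈ₗ xs → y ∈ₗ xs → 2 ≤ length xs
distinct-members⇒length≥2 {xs = _ ∷ _ ∷ _} _ _ _ = s≤s (s≤s z≤n)
distinct-members⇒length≥2 {xs = _ ∷ []} x≢y (hereₗ refl) (hereₗ refl) = ⊥-elim (x≢y refl)

injection-bound : ∀ {n k} (S : Subset n) (T : Subset k) (f : Fin n → Fin k) →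
  (∀ {i} → i ∈ S → f i ∈ T) →
  (∀ {i j} → i ∈ S → j ∈ S → f i ≡ f j → i ≡ j) →
  ∣ S ∣ ≤ ∣ T ∣
injection-bound [] T f maps inj = z≤n
injection-bound (outside ∷ S) T f maps inj =
  injection-bound S T (f ∘ suc) (maps ∘ there) (λ i∈S j∈S → suc-injective ∘ inj (there i∈S) (there j∈S))
injection-bound (inside ∷ S) T f maps inj =
  ≤-trans (s≤s (injection-bound S (T - f zero) (f ∘ suc) misses-f0
                  (λ i∈S j∈S → suc-injective ∘ inj (there i∈S) (there j∈S))))
          (x∈p⇒∣p-x∣<∣p∣ (maps here))
  where
  0≢suc : ∀ {n} {i : Fin n} → zero ≢ suc i
  0≢suc ()
  misses-f0 : ∀ {i} → i ∈ S → f (suc i) ∈ T - f zero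
  misses-f0 i∈S = x∈p∧x≢y⇒x∈p-y (maps (there i∈S)) (λ eq → 0≢suc (inj here (there i∈S) (sym eq)))

avoiding-index : ∀ {n} → 2 ≤ n → (k : ℕ) → ∃[ i ] (toℕ {n} i ≢ k)
avoiding-index (s≤s (s≤s _)) zero    = suc zero , λ ()
avoiding-index (s≤s (s≤s _)) (suc k) = zero , λ ()

other-index : ∀ {n} → 2 ≤ n → (i : Fin n) → ∃[ j ] (i ≢ j)
other-index 2≤n i with avoiding-index 2≤n (toℕ i)
... | j , toℕj≢toℕi = j , λ i≡j → toℕj≢toℕi (cong toℕ (sym i≡j))

splitAt-injective : ∀ m {n} {x y : Fin (m + n)} → splitAt m x ≡ splitAt m y → x ≡ y
splitAt-injective m {n} {x} {y} eq =
  trans (sym (join-splitAt m n x)) (trans (cong (join m n) eq) (join-splitAt m n y))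

↑ˡ≢↑ʳ : ∀ {m n} (i : Fin m) (j : Fin n) → i ↑ˡ n ≢ m ↑ʳ j
↑ˡ≢↑ʳ {m} {n} i j eq =
  <-irrefl (trans (sym (toℕ-↑ˡ i n)) (trans (cong toℕ eq) (toℕ-↑ʳ m j))) i<m+j
  where
  i<m+j : toℕ i < m + toℕ j
  i<m+j = <-≤-trans (toℕ<n i) (m≤m+n m (toℕ j))

module _ (G : Graph) where

  two-neighbours⇒degree≥2 : ∀ {v u w} → u ≢ w → Adj G v u → Adj G v w → 2 ≤ degree G v
  two-neighbours⇒degree≥2 {v} u≢w v~u v~w =
    distinct-members⇒length≥2 u≢w (neighbour v~u) (neighbour v~w)
    where
    neighbour : ∀ {x} → Adj G v x → x ∈ₗ filter (λ u → T? (adj G v u)) (allFin (n G))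
    neighbour v~x = ∈-filter⁺ (λ u → T? (adj G v u)) (∈-allFin _) v~x

  dynamic-separates-degree-two : ∀ {k} {c : Fin (n G) → Fin k} → IsDynamic G c →
    ∀ {v u w} → u ≢ w → Adj G v u → Adj G v w →
    (∀ x → Adj G v x → x ≡ u ⊎ x ≡ w) → c u ≢ c w
  dynamic-separates-degree-two {c = c} (_ , sees-two) {v} {u} {w} u≢w v~u v~w only cu≡cw
    with sees-two v (two-neighbours⇒degree≥2 u≢w v~u v~w)
  ... | x , y , v~x , v~y , cx≢cy = cx≢cy (trans (coloured-as-u (only x v~x)) (sym (coloured-as-u (only y v~y))))
    where
    coloured-as-u : ∀ {x} → x ≡ u ⊎ x ≡ w → c x ≡ c u
    coloured-as-u (inj₁ refl) = refl
    coloured-as-u (inj₂ refl) = sym cu≡cw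

  clique⇒colours≥ : ∀ {k l} (f : Fin k → Fin (n G)) → (∀ x y → x ≢ y → Adj G (f x) (f y)) →
    (c : Fin (n G) → Fin l) → IsProper G c → k ≤ l
  clique⇒colours≥ f clique c proper = injective⇒≤ {f = c ∘ f} injective
    where
    injective : ∀ {x y} → c (f x) ≡ c (f y) → x ≡ y
    injective {x} {y} eq with x ≟ y
    ... | yes x≡y = x≡y
    ... | no x≢y = ⊥-elim (proper (f x) (f y) (clique x y x≢y) eq)

  clique-cover-bound : ∀ {k} (κ : Fin (n G) → Fin k) →
    (∀ u w → κ u ≡ κ w → u ≡ w ⊎ Adj G u w) →
    ∀ S → IsIndependent G S → ∣ S ∣ ≤ k
  clique-cover-bound {k} κ cover S independent =
    subst (∣ S ∣ ≤_) (∣⊤∣≡n k) (injection-bound S ⊤ κ (λ _ → ∈⊤) injective)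
    where
    injective : ∀ {u w} → u ∈ S → w ∈ S → κ u ≡ κ w → u ≡ w
    injective {u} {w} u∈S w∈S eq with cover u w eq
    ... | inj₁ u≡w = u≡w
    ... | inj₂ u~w = ⊥-elim (independent u w u∈S w∈S u~w)

module RelationGraph {V : Set} {N : ℕ}
  (encode : V → Fin N) (decode : Fin N → V)
  (decode-encode : ∀ v → decode (encode v) ≡ v)
  (encode-decode : ∀ u → encode (decode u) ≡ u)
  (_~_ : V → V → Set) (_~?_ : Decidable _~_)
  (~-sym : ∀ {v w} → v ~ w → w ~ v) (~-irrefl : ∀ {v} → ¬ v ~ v)
  where

  isYes-sym : ∀ v w → isYes (v ~? w) ≡ isYes (w ~? v)
  isYes-sym v w with v ~? w | w ~? v
  ... | yes _   | yes _   = refl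
  ... | no _    | no _    = refl
  ... | yes v~w | no w≁v  = ⊥-elim (w≁v (~-sym v~w))
  ... | no v≁w  | yes w~v = ⊥-elim (v≁w (~-sym w~v))

  isYes-irrefl : ∀ v → isYes (v ~? v) ≡ false
  isYes-irrefl v with v ~? v
  ... | yes v~v = ⊥-elim (~-irrefl v~v)
  ... | no _    = refl

  graph : Graph
  graph = record
    { n        = N
    ; adj      = λ u w → isYes (decode u ~? decode w)
    ; sym      = λ u w → isYes-sym (decode u) (decode w)
    ; loopless = λ u → isYes-irrefl (decode u)
    }

  adj⁺ : ∀ {u w} → decode u ~ decode w → Adj graph u w
  adj⁺ = fromWitness

  adj⁻ : ∀ {u w} → Adj graph u w → decode u ~ decode w
  adj⁻ = toWitness

  adj-encode : ∀ {v w} → v ~ w → Adj graph (encode v) (encode w)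
  adj-encode {v} {w} v~w = adj⁺ (subst₂ _~_ (sym (decode-encode v)) (sym (decode-encode w)) v~w)

  encode-injective : ∀ {v w} → encode v ≡ encode w → v ≡ w
  encode-injective {v} {w} eq = trans (sym (decode-encode v)) (trans (cong decode eq) (decode-encode w))

  decode-injective : ∀ {u w} → decode u ≡ decode w → u ≡ w
  decode-injective {u} {w} eq = trans (sym (encode-decode u)) (trans (cong encode eq) (encode-decode w))

  neighbour-of-encode : ∀ {v u} → Adj graph (encode v) u → v ~ decode u
  neighbour-of-encode {v} v~u = subst (_~ _) (decode-encode v) (adj⁻ v~u)

  decodes-to : ∀ {u v} → decode u ≡ v → u ≡ encode v
  decodes-to {u} eq = trans (sym (encode-decode u)) (cong encode eq)

  lift-proper : ∀ {k} (col : V → Fin k) → (∀ {v w} → v ~ w → col v ≢ col w) →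
    IsProper graph (col ∘ decode)
  lift-proper col proper u w u~w = proper (adj⁻ u~w)

  lift-dynamic : ∀ {k} (col : V → Fin k) → (∀ {v w} → v ~ w → col v ≢ col w) →
    (∀ v → ∃[ x ] ∃[ y ] (v ~ x × v ~ y × col x ≢ col y)) →
    IsDynamic graph (col ∘ decode)
  lift-dynamic col proper sees-two =
    lift-proper col proper ,
    λ u _ → let x , y , u~x , u~y , cx≢cy = sees-two (decode u) in
      encode x , encode y ,
      adj⁺ (subst (decode u ~_) (sym (decode-encode x)) u~x) ,
      adj⁺ (subst (decode u ~_) (sym (decode-encode y)) u~y) ,
      λ eq → cx≢cy (trans (sym (cong col (decode-encode x))) (trans eq (cong col (decode-encode y))))

  selected : (V → Bool) → Subset N
  selected p = tabulate (λ u → p (decode u))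

  selected⁺ : ∀ p {v} → T (p v) → encode v ∈ selected p
  selected⁺ p {v} pv = lookup⇒[]= (encode v) (selected p)
    (trans (lookup∘tabulate (p ∘ decode) (encode v))
      (trans (cong p (decode-encode v)) (Equivalence.to T-≡ pv)))

  selected⁻ : ∀ p {u} → u ∈ selected p → T (p (decode u))
  selected⁻ p {u} u∈ = Equivalence.from T-≡
    (trans (sym (lookup∘tabulate (p ∘ decode) u)) ([]=⇒lookup u∈))

module Construction (m a : ℕ) (2≤m : 2 ≤ m) (m<a : m < a) where

  data Vertex : Set where
    X P : Fin m → Vertex
    C   : Fin a → Vertex

  -- Cᵢ is the partner of Pᵢ and Xᵢ; Cₘ (the vertex `spare`) has no partner.
  partner : Fin m → Fin a
  partner i = inject≤ i (<⇒≤ m<a)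

  spare : Fin a
  spare = fromℕ< m<a

  partner-injective : ∀ {i i′} → partner i ≡ partner i′ → i ≡ i′
  partner-injective = inject≤-injective _ _ _ _

  partner≢spare : ∀ i → partner i ≢ spare
  partner≢spare i eq = <-irrefl
    (trans (sym (toℕ-inject≤ i _)) (trans (cong toℕ eq) (toℕ-fromℕ< m<a))) (toℕ<n i)

  _~_ : Vertex → Vertex → Set
  X i ~ X i′ = ⊥
  X i ~ P i′ = i ≡ i′
  X i ~ C j  = partner i ≡ j
  P i ~ X i′ = i′ ≡ i
  P i ~ P i′ = i ≢ i′
  P i ~ C j  = partner i ≢ j
  C j ~ X i  = partner i ≡ j
  C j ~ P i  = partner i ≢ j
  C j ~ C j′ = j ≢ j′

  _~?_ : Decidable _~_
  X i ~? X i′ = no (λ ())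
  X i ~? P i′ = i ≟ i′
  X i ~? C j  = partner i ≟ j
  P i ~? X i′ = i′ ≟ i
  P i ~? P i′ = ¬? (i ≟ i′)
  P i ~? C j  = ¬? (partner i ≟ j)
  C j ~? X i  = partner i ≟ j
  C j ~? P i  = ¬? (partner i ≟ j)
  C j ~? C j′ = ¬? (j ≟ j′)

  ~-sym : ∀ {v w} → v ~ w → w ~ v
  ~-sym {X _} {P _} e = e
  ~-sym {X _} {C _} e = e
  ~-sym {P _} {X _} e = e
  ~-sym {P _} {P _} e = ≢-sym e
  ~-sym {P _} {C _} e = e
  ~-sym {C _} {X _} e = e
  ~-sym {C _} {P _} e = e
  ~-sym {C _} {C _} e = ≢-sym e

  ~-irrefl : ∀ {v} → ¬ v ~ v
  ~-irrefl {X _} ()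
  ~-irrefl {P _} i≢i = i≢i refl
  ~-irrefl {C _} j≢j = j≢j refl

  N : ℕ
  N = m + (m + a)

  encode : Vertex → Fin N
  encode (X i) = i ↑ˡ (m + a)
  encode (P i) = m ↑ʳ (i ↑ˡ a)
  encode (C j) = m ↑ʳ (m ↑ʳ j)

  decode : Fin N → Vertex
  decode u = [ X , (λ r → [ P , C ] (splitAt m r)) ] (splitAt m u)

  decode-encode : ∀ v → decode (encode v) ≡ v
  decode-encode (X i) rewrite splitAt-↑ˡ m i (m + a) = refl
  decode-encode (P i) rewrite splitAt-↑ʳ m (m + a) (i ↑ˡ a) | splitAt-↑ˡ m i a = refl
  decode-encode (C j) rewrite splitAt-↑ʳ m (m + a) (m ↑ʳ j) | splitAt-↑ʳ m a j = refl

  encode-decode : ∀ u → encode (decode u) ≡ u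
  encode-decode u with splitAt m u in eq
  ... | inj₁ i = splitAt⁻¹-↑ˡ eq
  ... | inj₂ r with splitAt m r in eq′
  ...   | inj₁ i = trans (cong (m ↑ʳ_) (splitAt⁻¹-↑ˡ eq′)) (splitAt⁻¹-↑ʳ eq)
  ...   | inj₂ j = trans (cong (m ↑ʳ_) (splitAt⁻¹-↑ʳ eq′)) (splitAt⁻¹-↑ʳ eq)

  open RelationGraph encode decode decode-encode encode-decode _~_ _~?_ ~-sym ~-irrefl public

  -- χ(G) = a.

  chromatic-colouring : Vertex → Fin a
  chromatic-colouring (X _) = spare
  chromatic-colouring (P i) = partner i
  chromatic-colouring (C j) = j

  chromatic-colouring-proper : ∀ {v w} → v ~ w → chromatic-colouring v ≢ chromatic-colouring w
  chromatic-colouring-proper {X i} {P _} refl eq = partner≢spare i (sym eq)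
  chromatic-colouring-proper {X i} {C _} refl eq = partner≢spare i (sym eq)
  chromatic-colouring-proper {P i} {X _} refl eq = partner≢spare i eq
  chromatic-colouring-proper {P _} {P _} i≢i′ eq = i≢i′ (partner-injective eq)
  chromatic-colouring-proper {P _} {C _} ne      = ne
  chromatic-colouring-proper {C _} {X i} refl eq = partner≢spare i eq
  chromatic-colouring-proper {C _} {P _} ne      = ne ∘ sym
  chromatic-colouring-proper {C _} {C _} ne      = ne

  chromatic : ChromaticNumber graph a
  chromatic =
    (chromatic-colouring ∘ decode , lift-proper chromatic-colouring chromatic-colouring-proper) ,
    λ k (c , proper) → clique⇒colours≥ graph (encode ∘ C) (λ j j′ → adj-encode {C j} {C j′}) c proper

  -- α(G) = m + 1.

  cover : Vertex → Fin (suc m)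
  cover (X i) = suc i
  cover (P i) = suc i
  cover (C _) = zero

  cover-cliques : ∀ v w → cover v ≡ cover w → v ≡ w ⊎ v ~ w
  cover-cliques (X _) (X _) refl = inj₁ refl
  cover-cliques (X _) (P _) refl = inj₂ refl
  cover-cliques (P _) (X _) refl = inj₂ refl
  cover-cliques (P _) (P _) refl = inj₁ refl
  cover-cliques (C j) (C j′) _ with j ≟ j′
  ... | yes refl = inj₁ refl
  ... | no j≢j′  = inj₂ j≢j′

  independent-bound : ∀ S → IsIndependent graph S → ∣ S ∣ ≤ suc m
  independent-bound = clique-cover-bound graph (cover ∘ decode) λ u w eq →
    ⊎-map decode-injective adj⁺ (cover-cliques (decode u) (decode w) eq)

  in-stable : Vertex → Bool
  in-stable (X _) = true
  in-stable (P _) = false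
  in-stable (C j) = isYes (j ≟ spare)

  stable : Subset N
  stable = selected in-stable

  stable-independent : IsIndependent graph stable
  stable-independent u w u∈ w∈ u~w =
    no-edge (decode u) (decode w) (selected⁻ in-stable u∈) (selected⁻ in-stable w∈) (adj⁻ u~w)
    where
    no-edge : ∀ v w → T (in-stable v) → T (in-stable w) → ¬ v ~ w
    no-edge (X _) (X _) _ _ ()
    no-edge (X i) (C _) _ w-spare e = partner≢spare i (trans e (toWitness w-spare))
    no-edge (C _) (X i) v-spare _ e = partner≢spare i (trans e (toWitness v-spare))
    no-edge (C _) (C _) v-spare w-spare ne = ne (trans (toWitness v-spare) (sym (toWitness w-spare)))

  listing : Fin (suc m) → Vertex
  listing zero    = C spare
  listing (suc i) = X i

  listing-injective : ∀ {x y} → listing x ≡ listing y → x ≡ y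
  listing-injective {zero}  {zero}  _    = refl
  listing-injective {suc _} {suc _} refl = refl

  listing-stable : ∀ x → T (in-stable (listing x))
  listing-stable zero    = fromWitness refl
  listing-stable (suc _) = _

  stable-size : ∣ stable ∣ ≡ suc m
  stable-size = ≤-antisym (independent-bound stable stable-independent)
    (subst (_≤ ∣ stable ∣) (∣⊤∣≡n (suc m))
      (injection-bound ⊤ stable (encode ∘ listing)
        (λ {x} _ → selected⁺ in-stable {listing x} (listing-stable x))
        (λ _ _ → listing-injective ∘ encode-injective)))

  independence : IndependenceNumber graph (suc m)
  independence = (stable , stable-independent , stable-size) , independent-bound

  -- χ₂(G) = a + m.

  dynamic-colouring : Vertex → Fin (a + m)
  dynamic-colouring (X _) = spare ↑ˡ m
  dynamic-colouring (P i) = a ↑ʳ i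
  dynamic-colouring (C j) = j ↑ˡ m

  dynamic-colouring-proper : ∀ {v w} → v ~ w → dynamic-colouring v ≢ dynamic-colouring w
  dynamic-colouring-proper {X _} {P i} _    = ↑ˡ≢↑ʳ spare i
  dynamic-colouring-proper {X i} {C _} refl = partner≢spare i ∘ sym ∘ ↑ˡ-injective m _ _
  dynamic-colouring-proper {P i} {X _} _    = ↑ˡ≢↑ʳ spare i ∘ sym
  dynamic-colouring-proper {P _} {P _} ne   = ne ∘ ↑ʳ-injective a _ _
  dynamic-colouring-proper {P i} {C j} _    = ↑ˡ≢↑ʳ j i ∘ sym
  dynamic-colouring-proper {C _} {X i} refl = partner≢spare i ∘ ↑ˡ-injective m _ _
  dynamic-colouring-proper {C j} {P i} _    = ↑ˡ≢↑ʳ j i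
  dynamic-colouring-proper {C _} {C _} ne   = ne ∘ ↑ˡ-injective m _ _

  -- Every vertex has a neighbour in C ∪ X and one in P, which see different palettes.
  sees-two-colours : ∀ v → ∃[ x ] ∃[ y ] (v ~ x × v ~ y × dynamic-colouring x ≢ dynamic-colouring y)
  sees-two-colours (X i) = C (partner i) , P i , refl , refl , ↑ˡ≢↑ʳ (partner i) i
  sees-two-colours (P i) with other-index 2≤m i
  ... | i′ , i≢i′ = X i , P i′ , refl , i≢i′ , ↑ˡ≢↑ʳ spare i′
  sees-two-colours (C j) with other-index (≤-trans 2≤m (<⇒≤ m<a)) j | avoiding-index 2≤m (toℕ j)
  ... | j′ , j≢j′ | i , toℕi≢toℕj =
    C j′ , P i , j≢j′ , unpartnered , ↑ˡ≢↑ʳ j′ i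
    where
    unpartnered : partner i ≢ j
    unpartnered eq = toℕi≢toℕj (trans (sym (toℕ-inject≤ i _)) (cong toℕ eq))

  X-neighbours : ∀ {i} w → X i ~ w → w ≡ P i ⊎ w ≡ C (partner i)
  X-neighbours (P _) refl = inj₁ refl
  X-neighbours (C _) refl = inj₂ refl

  module Rainbow {k} (c : Fin N → Fin k) (dynamic : IsDynamic graph c) where

    partners-separated : ∀ i → c (encode (P i)) ≢ c (encode (C (partner i)))
    partners-separated i =
      dynamic-separates-degree-two graph dynamic (λ eq → P≢C (encode-injective eq))
        (adj-encode {X i} {P i} refl) (adj-encode {X i} {C (partner i)} refl)
        (λ u Xi~u → ⊎-map decodes-to decodes-to (X-neighbours (decode u) (neighbour-of-encode Xi~u)))
      where
      P≢C : P i ≢ C (partner i)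
      P≢C ()

    rainbow : Fin a ⊎ Fin m → Vertex
    rainbow = [ C , P ]

    rainbow-separated : ∀ s t → c (encode (rainbow s)) ≡ c (encode (rainbow t)) → s ≡ t
    rainbow-separated (inj₁ j) (inj₁ j′) eq with j ≟ j′
    ... | yes refl = refl
    ... | no j≢j′  = ⊥-elim (proj₁ dynamic _ _ (adj-encode {C j} {C j′} j≢j′) eq)
    rainbow-separated (inj₂ i) (inj₂ i′) eq with i ≟ i′
    ... | yes refl = refl
    ... | no i≢i′  = ⊥-elim (proj₁ dynamic _ _ (adj-encode {P i} {P i′} i≢i′) eq)
    rainbow-separated (inj₁ j) (inj₂ i) eq with partner i ≟ j
    ... | yes refl = ⊥-elim (partners-separated i (sym eq))
    ... | no ne    = ⊥-elim (proj₁ dynamic _ _ (adj-encode {C j} {P i} ne) eq)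
    rainbow-separated (inj₂ i) (inj₁ j) eq with partner i ≟ j
    ... | yes refl = ⊥-elim (partners-separated i eq)
    ... | no ne    = ⊥-elim (proj₁ dynamic _ _ (adj-encode {P i} {C j} ne) eq)

    colours≥ : a + m ≤ k
    colours≥ = injective⇒≤ {f = c ∘ encode ∘ rainbow ∘ splitAt a}
      (λ eq → splitAt-injective a (rainbow-separated _ _ eq))

  dynamic-chromatic : DynamicChromaticNumber graph (a + m)
  dynamic-chromatic =
    (dynamic-colouring ∘ decode ,
     lift-dynamic dynamic-colouring dynamic-colouring-proper sees-two-colours) ,
    λ k (c , dynamic) → Rainbow.colours≥ c dynamic

proposition1 : (a b : ℕ) → 3 ≤ b → b ≤ a →
    ∃[ G ] ∃[ c₂ ] (ChromaticNumber G a × IndependenceNumber G b ×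
      DynamicChromaticNumber G c₂ × c₂ + 1 ≡ b + a)
proposition1 a (suc m) (s≤s 2≤m) m<a =
  graph , a + m , chromatic , independence , dynamic-chromatic , count
  where
  open Construction m a 2≤m m<a
  count : a + m + 1 ≡ suc m + a
  count = trans (+-comm (a + m) 1) (cong suc (+-comm a m))
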